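{- For every graph $G$, $\mathrm{had}(G)/2\le \mathrm{had}_b(G)\le \mathrm{had}(G)$.
   Context: All graphs are finite, simple and undirected. A minor model of $H$ in $G$ is a family $(X_u)_{u\in V(H)}$ of nonempty pairwise disjoint vertex sets of $G$ such that each $G[X_u]$ is connected and for every edge $uv$ of $H$ there is an edge of $G$ between $X_u$ and $X_v$; it is balanced if all $X_u$ have the same size. $\mathrm{had}(G)$ is the largest $k$ such that $K_k$ is a minor of $G$, and $\mathrm{had}_b(G)$ is the largest $k$ such that $G$ has a balanced minor model of $K_k$. -}

module Defs where

open import Data.Nat using (ℕ; _≤_; _*_)
open import Data.Fin using (Fin)
open import Data.Fin.Subset using (Subset; _∈_; _∉_; ∣_∣)
open import Data.Product using (Σ; ∃; _×_)
open import Relation.Nullary using (¬_)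
open import Relation.Binary.PropositionalEquality using (_≡_; _≢_)
open import Level using (0ℓ; suc)

record Graph : Set₁ where
  field
    n      : ℕ
    Adj    : Fin n → Fin n → Set
    sym    : ∀ {u v} → Adj u v → Adj v u
    irrefl : ∀ {u} → ¬ Adj u u
open Graph public

data Connected (G : Graph) (S : Subset (n G)) : Fin (n G) → Fin (n G) → Set where
  here : ∀ {u} → u ∈ S → Connected G S u u
  step : ∀ {u w v} → u ∈ S → Adj G u w → Connected G S w v → Connected G S u v

-- G[S] is connected (S is intended nonempty; nonemptiness is required separately).
InducedConnected : (G : Graph) → Subset (n G) → Set
InducedConnected G S = ∀ {u v} → u ∈ S → v ∈ S → Connected G S u v

record KMinorModel (G : Graph) (k : ℕ) : Set where
  field
    X         : Fin k → Subset (n G)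
    nonempty  : ∀ i → ∃ λ v → v ∈ X i
    disjoint  : ∀ {i j} → i ≢ j → ∀ {v} → v ∈ X i → v ∉ X j
    connected : ∀ i → InducedConnected G (X i)
    adjacent  : ∀ {i j} → i ≢ j →
                Σ (Fin (n G)) λ u → Σ (Fin (n G)) λ v → u ∈ X i × v ∈ X j × Adj G u v
open KMinorModel public

Balanced : {G : Graph} {k : ℕ} → KMinorModel G k → Set
Balanced M = ∀ i j → ∣ X M i ∣ ≡ ∣ X M j ∣

HasKMinor : Graph → ℕ → Set
HasKMinor G k = KMinorModel G k

HasBalancedKMinor : Graph → ℕ → Set
HasBalancedKMinor G k = Σ (KMinorModel G k) Balanced

IsHad : Graph → ℕ → Set
IsHad G h = HasKMinor G h × (∀ k → HasKMinor G k → k ≤ h)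

IsHadB : Graph → ℕ → Set
IsHadB G b = HasBalancedKMinor G b × (∀ k → HasBalancedKMinor G k → k ≤ b)

-- Take branch sets X₁, …, X_h of a K_h model and pair the smallest with the
-- largest, the second smallest with the second largest, and so on; an odd
-- one out forms a pair on its own. If s is the size of the median branch
-- set, every pair consists of a set of size at most s and one of size at
-- least s, and the two sets touch. Growing the smaller set one vertex at a
-- time inside the (connected) union of the pair yields a connected set of
-- size exactly s containing it. These ⌈h/2⌉ new sets are disjoint, and any
-- two of them are adjacent because they contain distinct original branch
-- sets, so they form a balanced model of K_⌈h/2⌉.
module Submission where

open import Defs
open import Data.Nat using (ℕ; zero; suc; _≤_; _<_; _*_; _+_; _∸_; z≤n; s≤s; z<s)
open import Data.Nat.Properties
  using (≤-refl; ≤-trans; ≤-total; ≤-reflexive; <⇒≱; +-suc; +-identityʳ; m<m+n; *-suc; *-monoʳ-≤; m+[n∸m]≡n)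
open import Data.Fin using (Fin; zero; suc; punchIn; _≟_)
open import Data.Fin.Properties using (any?; punchIn-injective; punchInᵢ≢i)
open import Data.Fin.Subset using (Subset; inside; outside; _∈_; _∉_; _⊆_; _∪_; ⁅_⁆; ∣_∣)
open import Data.Fin.Subset.Properties
  using (_∈?_; x∈⁅x⁆; x∈⁅y⁆⇒x≡y; p⊆q⇒∣p∣≤∣q∣; p⊆p∪q; q⊆p∪q; x∈p∪q⁻; ∣q∣≤∣p∪q∣; ∪-idem; ∪-identityʳ)
open import Data.Vec using (_∷_; here; there)
open import Data.Product using (Σ; ∃; _×_; _,_; proj₂)
open import Data.Sum using (_⊎_; inj₁; inj₂; [_,_]′)
open import Data.Empty using (⊥-elim)
open import Function using (id; _∘_)
open import Relation.Binary.Definitions using (Transitive; Total)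
open import Relation.Nullary using (¬_; contradiction)
open import Relation.Nullary.Decidable using (yes; no; ¬?; _×-dec_; decidable-stable)
open import Relation.Binary.PropositionalEquality
  using (_≡_; _≢_; refl; trans; cong; subst)
  renaming (sym to ≡-sym)

x∉p⇒∣p∪⁅x⁆∣≡1+∣p∣ : ∀ {n} {p : Subset n} {x : Fin n} → x ∉ p → ∣ p ∪ ⁅ x ⁆ ∣ ≡ suc ∣ p ∣
x∉p⇒∣p∪⁅x⁆∣≡1+∣p∣ {p = outside ∷ p} {zero}  x∉p = cong suc (cong ∣_∣ (∪-identityʳ p))
x∉p⇒∣p∪⁅x⁆∣≡1+∣p∣ {p = inside  ∷ p} {zero}  x∉p = contradiction here x∉p
x∉p⇒∣p∪⁅x⁆∣≡1+∣p∣ {p = outside ∷ p} {suc x} x∉p = x∉p⇒∣p∪⁅x⁆∣≡1+∣p∣ (x∉p ∘ there)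
x∉p⇒∣p∪⁅x⁆∣≡1+∣p∣ {p = inside  ∷ p} {suc x} x∉p = cong suc (x∉p⇒∣p∪⁅x⁆∣≡1+∣p∣ (x∉p ∘ there))

∣p∣<∣q∣⇒∃x∈q∖p : ∀ {n} {p q : Subset n} → ∣ p ∣ < ∣ q ∣ → ∃ λ x → x ∈ q × x ∉ p
∣p∣<∣q∣⇒∃x∈q∖p {p = p} {q} ∣p∣<∣q∣ with any? (λ x → x ∈? q ×-dec ¬? (x ∈? p))
... | yes found = found
... | no none = contradiction (p⊆q⇒∣p∣≤∣q∣ q⊆p) (<⇒≱ ∣p∣<∣q∣)
  where
  q⊆p : q ⊆ p
  q⊆p {x} x∈q = decidable-stable (x ∈? p) (λ x∉p → none (x , x∈q , x∉p))

module _ (G : Graph) where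

  private
    V   = Fin (n G)
    Sub = Subset (n G)

  Connected-source : ∀ {S : Sub} {u v} → Connected G S u v → u ∈ S
  Connected-source (here u∈S)     = u∈S
  Connected-source (step u∈S _ _) = u∈S

  Connected-mono : ∀ {S S' : Sub} → S ⊆ S' → ∀ {u v} → Connected G S u v → Connected G S' u v
  Connected-mono S⊆S' (here u∈S)         = here (S⊆S' u∈S)
  Connected-mono S⊆S' (step u∈S uw walk) = step (S⊆S' u∈S) uw (Connected-mono S⊆S' walk)

  Connected-trans : ∀ {S : Sub} {u w v} → Connected G S u w → Connected G S w v → Connected G S u v
  Connected-trans (here _)           walk' = walk'
  Connected-trans (step u∈S uw walk) walk' = step u∈S uw (Connected-trans walk walk')

  Connected-exit : ∀ {S : Sub} (T : Sub) {u v} → Connected G S u v → u ∈ T → v ∉ T →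
    Σ V λ y → Σ V λ w → y ∈ T × w ∈ S × w ∉ T × Adj G y w
  Connected-exit T (here _)                u∈T v∉T = contradiction u∈T v∉T
  Connected-exit T {u} (step {w = w} _ uw walk) u∈T v∉T with w ∈? T
  ... | yes w∈T = Connected-exit T walk w∈T v∉T
  ... | no  w∉T = u , w , u∈T , Connected-source walk , w∉T , uw

  InducedConnected-⁅⁆ : (w : V) → InducedConnected G ⁅ w ⁆
  InducedConnected-⁅⁆ w {u} {v} u∈⁅w⁆ v∈⁅w⁆ with x∈⁅y⁆⇒x≡y w u∈⁅w⁆ | x∈⁅y⁆⇒x≡y w v∈⁅w⁆
  ... | refl | refl = here u∈⁅w⁆

  InducedConnected-∪ : ∀ {A B : Sub} → InducedConnected G A → InducedConnected G B →
    ∀ {a b} → a ∈ A → b ∈ B → Adj G a b → InducedConnected G (A ∪ B)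
  InducedConnected-∪ {A} {B} conA conB a∈A b∈B ab u∈A∪B v∈A∪B
    with x∈p∪q⁻ A B u∈A∪B | x∈p∪q⁻ A B v∈A∪B
  ... | inj₁ u∈A | inj₁ v∈A = Connected-mono (p⊆p∪q B) (conA u∈A v∈A)
  ... | inj₂ u∈B | inj₂ v∈B = Connected-mono (q⊆p∪q A B) (conB u∈B v∈B)
  ... | inj₁ u∈A | inj₂ v∈B = Connected-trans (Connected-mono (p⊆p∪q B) (conA u∈A a∈A))
      (step (p⊆p∪q B a∈A) ab (Connected-mono (q⊆p∪q A B) (conB b∈B v∈B)))
  ... | inj₂ u∈B | inj₁ v∈A = Connected-trans (Connected-mono (q⊆p∪q A B) (conB u∈B b∈B))
      (step (q⊆p∪q A B b∈B) (sym G ab) (Connected-mono (p⊆p∪q B) (conA a∈A v∈A)))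

  ∃-edge-leaving : ∀ {A S : Sub} {x} → InducedConnected G S → A ⊆ S → x ∈ A → ∣ A ∣ < ∣ S ∣ →
    Σ V λ y → Σ V λ w → y ∈ A × w ∈ S × w ∉ A × Adj G y w
  ∃-edge-leaving {A} conS A⊆S x∈A ∣A∣<∣S∣ with ∣p∣<∣q∣⇒∃x∈q∖p ∣A∣<∣S∣
  ... | u , u∈S , u∉A = Connected-exit A (conS (A⊆S x∈A) u∈S) x∈A u∉A

  record ConnectedExtension (A S : Sub) (m : ℕ) : Set where
    field
      T           : Sub
      A⊆T         : A ⊆ T
      T⊆S         : T ⊆ S
      ∣T∣≡m       : ∣ T ∣ ≡ m
      T-connected : InducedConnected G T

  open ConnectedExtension

  grow-by-one : ∀ {A S : Sub} {x} → A ⊆ S → x ∈ A → InducedConnected G A → InducedConnected G S →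
    ∣ A ∣ < ∣ S ∣ → ConnectedExtension A S (suc ∣ A ∣)
  grow-by-one {A} {S} A⊆S x∈A conA conS ∣A∣<∣S∣ with ∃-edge-leaving conS A⊆S x∈A ∣A∣<∣S∣
  ... | y , w , y∈A , w∈S , w∉A , yw = record
    { T           = A ∪ ⁅ w ⁆
    ; A⊆T         = p⊆p∪q ⁅ w ⁆
    ; T⊆S         = λ v∈A+w → [ A⊆S , (λ v∈⁅w⁆ → subst (_∈ S) (≡-sym (x∈⁅y⁆⇒x≡y w v∈⁅w⁆)) w∈S) ]′
                                (x∈p∪q⁻ A ⁅ w ⁆ v∈A+w)
    ; ∣T∣≡m       = x∉p⇒∣p∪⁅x⁆∣≡1+∣p∣ w∉A
    ; T-connected = InducedConnected-∪ conA (InducedConnected-⁅⁆ w) y∈A (x∈⁅x⁆ w) yw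
    }

  extend-connected : ∀ {A S : Sub} {x} → A ⊆ S → x ∈ A → InducedConnected G A → InducedConnected G S →
    ∀ {m} → ∣ A ∣ ≤ m → m ≤ ∣ S ∣ → ConnectedExtension A S m
  extend-connected {A} {S} A⊆S x∈A conA conS {m} ∣A∣≤m m≤∣S∣ =
    extend-by (m ∸ ∣ A ∣) A⊆S x∈A conA (m+[n∸m]≡n ∣A∣≤m)
    where
    extend-by : ∀ d {A : Sub} {x} → A ⊆ S → x ∈ A → InducedConnected G A → ∣ A ∣ + d ≡ m →
      ConnectedExtension A S m
    extend-by zero {A} A⊆S _ conA ∣A∣+0≡m = record
      { T = A ; A⊆T = id ; T⊆S = A⊆S ; ∣T∣≡m = trans (≡-sym (+-identityʳ ∣ A ∣)) ∣A∣+0≡m ; T-connected = conA }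
    extend-by (suc d) {A} A⊆S x∈A conA ∣A∣+1+d≡m = record
      { T = T E ; A⊆T = A⊆T E ∘ A⊆T E₁ ; T⊆S = T⊆S E ; ∣T∣≡m = ∣T∣≡m E ; T-connected = T-connected E }
      where
      E₁ : ConnectedExtension A S (suc ∣ A ∣)
      E₁ = grow-by-one A⊆S x∈A conA conS (≤-trans (subst (∣ A ∣ <_) ∣A∣+1+d≡m (m<m+n ∣ A ∣ z<s)) m≤∣S∣)
      E : ConnectedExtension (T E₁) S m
      E = extend-by d (T⊆S E₁) (A⊆T E₁ x∈A) (T-connected E₁)
            (trans (cong (_+ d) (∣T∣≡m E₁)) (trans (≡-sym (+-suc ∣ A ∣ d)) ∣A∣+1+d≡m))

module _ {a ℓ} {A : Set a} {_≼_ : A → A → Set ℓ} (≼-trans : Transitive _≼_) (≼-total : Total _≼_) where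

  ≼-refl : ∀ x → x ≼ x
  ≼-refl x = [ id , id ]′ (≼-total x x)

  least : ∀ {m} (f : Fin (suc m) → A) → ∃ λ i → ∀ j → f i ≼ f j
  least {zero}  f = zero , λ { zero → ≼-refl (f zero) }
  least {suc m} f with least (f ∘ suc)
  ... | i , fi≼ with ≼-total (f zero) (f (suc i))
  ...   | inj₁ f0≼fi = zero , λ { zero → ≼-refl (f zero) ; (suc j) → ≼-trans f0≼fi (fi≼ j) }
  ...   | inj₂ fi≼f0 = suc i , λ { zero → fi≼f0 ; (suc j) → fi≼ j }

argmin : ∀ {m} (f : Fin (suc m) → ℕ) → ∃ λ i → ∀ j → f i ≤ f j
argmin = least ≤-trans ≤-total

argmax : ∀ {m} (f : Fin (suc m) → ℕ) → ∃ λ i → ∀ j → f j ≤ f i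
argmax = least {_≼_ = λ x y → y ≤ x} (λ y≤x z≤y → ≤-trans z≤y y≤x) (λ x y → ≤-total y x)

-- A pair may be degenerate: small j ≡ large j.
record Pairing {h : ℕ} (f : Fin h → ℕ) (s : ℕ) : Set where
  field
    k           : ℕ
    h≤2k        : h ≤ 2 * k
    small large : Fin k → Fin h
    small≤s     : ∀ j → f (small j) ≤ s
    s≤large     : ∀ j → s ≤ f (large j)

  _∈ₚ_ : Fin h → Fin k → Set
  i ∈ₚ j = i ≡ small j ⊎ i ≡ large j

  field
    ∈ₚ-unique : ∀ {i j j'} → i ∈ₚ j → i ∈ₚ j' → j ≡ j'

emptyPairing : ∀ {f : Fin 0 → ℕ} {s} → Pairing f s
emptyPairing = record
  { k = 0 ; h≤2k = z≤n ; small = λ () ; large = λ () ; small≤s = λ () ; s≤large = λ ()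
  ; ∈ₚ-unique = λ { {j = ()} } }

singletonPairing : (f : Fin 1 → ℕ) → Pairing f (f zero)
singletonPairing f = record
  { k = 1 ; h≤2k = s≤s z≤n ; small = λ _ → zero ; large = λ _ → zero
  ; small≤s = λ _ → ≤-refl ; s≤large = λ _ → ≤-refl
  ; ∈ₚ-unique = λ { {j = zero} {zero} _ _ → refl } }

consPairing : ∀ {n} (f : Fin (suc (suc n)) → ℕ) (a : Fin (suc (suc n))) (c' : Fin (suc n)) {s} →
  f a ≤ s → s ≤ f (punchIn a c') → Pairing (f ∘ punchIn a ∘ punchIn c') s → Pairing f s
consPairing {n} f a c' fa≤s s≤fc P = record
  { k = suc P.k
  ; h≤2k = ≤-trans (s≤s (s≤s P.h≤2k)) (≤-reflexive (≡-sym (*-suc 2 P.k)))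
  ; small = small
  ; large = large
  ; small≤s = λ { zero → fa≤s ; (suc j) → P.small≤s j }
  ; s≤large = λ { zero → s≤fc ; (suc j) → P.s≤large j }
  ; ∈ₚ-unique = ∈ₚ-unique
  }
  where
  module P = Pairing P

  ρ : Fin n → Fin (suc (suc n))
  ρ = punchIn a ∘ punchIn c'

  ρ-injective : ∀ {i i'} → ρ i ≡ ρ i' → i ≡ i'
  ρ-injective ρi≡ρi' = punchIn-injective c' _ _ (punchIn-injective a _ _ ρi≡ρi')

  small large : Fin (suc P.k) → Fin (suc (suc n))
  small zero    = a
  small (suc j) = ρ (P.small j)
  large zero    = punchIn a c'
  large (suc j) = ρ (P.large j)

  _∈ₚ_ : Fin (suc (suc n)) → Fin (suc P.k) → Set
  i ∈ₚ j = i ≡ small j ⊎ i ≡ large j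

  ρ-∉ₚ-zero : ∀ i → ¬ (ρ i ∈ₚ zero)
  ρ-∉ₚ-zero i (inj₁ ρi≡a) = punchInᵢ≢i a _ ρi≡a
  ρ-∉ₚ-zero i (inj₂ ρi≡c) = punchInᵢ≢i c' i (punchIn-injective a _ _ ρi≡c)

  ∈ₚ-suc : ∀ {i j} → i ∈ₚ suc j → ∃ λ i₀ → i ≡ ρ i₀ × i₀ P.∈ₚ j
  ∈ₚ-suc (inj₁ refl) = _ , refl , inj₁ refl
  ∈ₚ-suc (inj₂ refl) = _ , refl , inj₂ refl

  ∈ₚ-unique : ∀ {i j j'} → i ∈ₚ j → i ∈ₚ j' → j ≡ j'
  ∈ₚ-unique {j = zero}  {zero}   _    _ = refl
  ∈ₚ-unique {j = zero}  {suc _}  i∈j₀ i∈j' with ∈ₚ-suc i∈j'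
  ... | i₀ , refl , _ = ⊥-elim (ρ-∉ₚ-zero i₀ i∈j₀)
  ∈ₚ-unique {j = suc _} {zero}   i∈j  i∈j₀ with ∈ₚ-suc i∈j
  ... | i₀ , refl , _ = ⊥-elim (ρ-∉ₚ-zero i₀ i∈j₀)
  ∈ₚ-unique {j = suc _} {suc j'} i∈j  i∈j' with ∈ₚ-suc i∈j | ∈ₚ-suc i∈j'
  ... | i₀ , refl , i₀∈j | i₁ , ρi₀≡ρi₁ , i₁∈j' =
    cong suc (P.∈ₚ-unique i₀∈j (subst (P._∈ₚ j') (≡-sym (ρ-injective ρi₀≡ρi₁)) i₁∈j'))

-- Peel off the smallest value and the largest remaining one; the median of
-- what is left then lies between them.
pairing : ∀ {h} (f : Fin (suc h) → ℕ) → ∃ λ m → Pairing f (f m)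
pairing {zero} f = zero , singletonPairing f
pairing {suc zero} f with argmin f
... | a , fa≤ = a , consPairing f a zero ≤-refl (fa≤ _) emptyPairing
pairing {suc (suc h)} f with argmin f
... | a , fa≤ with argmax (f ∘ punchIn a)
...   | c' , ≤fc with pairing (f ∘ punchIn a ∘ punchIn c')
...     | m , P = punchIn a (punchIn c' m) , consPairing f a c' (fa≤ _) (≤fc (punchIn c' m)) P

module _ {G : Graph} where

  modelOfSupersets : ∀ {h k} (M : KMinorModel G h) (anchor : Fin k → Fin h) (Y : Fin k → Subset (n G)) →
    (∀ j → X M (anchor j) ⊆ Y j) → (∀ j → InducedConnected G (Y j)) →
    (∀ {j j'} → j ≢ j' → ∀ {v} → v ∈ Y j → v ∉ Y j') → KMinorModel G k
  modelOfSupersets M anchor Y X⊆Y conY disjY = record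
    { X = Y
    ; nonempty = λ j → let (v , v∈X) = nonempty M (anchor j) in v , X⊆Y j v∈X
    ; disjoint = disjY
    ; connected = conY
    ; adjacent = λ j≢j' → let (u , v , u∈X , v∈X , uv) = adjacent M (anchor-≢ j≢j')
                          in u , v , X⊆Y _ u∈X , X⊆Y _ v∈X , uv
    }
    where
    anchor-≢ : ∀ {j j'} → j ≢ j' → anchor j ≢ anchor j'
    anchor-≢ {j} {j'} j≢j' aj≡aj' =
      let (v , v∈X) = nonempty M (anchor j)
      in disjY j≢j' (X⊆Y j v∈X) (X⊆Y j' (subst (λ i → v ∈ X M i) aj≡aj' v∈X))

  InducedConnected-branch-∪ : ∀ {h} (M : KMinorModel G h) (i i' : Fin h) →
    InducedConnected G (X M i ∪ X M i')
  InducedConnected-branch-∪ M i i' with i ≟ i'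
  ... | yes refl = subst (InducedConnected G) (≡-sym (∪-idem (X M i))) (connected M i)
  ... | no i≢i' with adjacent M i≢i'
  ...   | u , v , u∈X , v∈X , uv = InducedConnected-∪ G (connected M i) (connected M i') u∈X v∈X uv

  balancedModelOfPairing : ∀ {h s} (M : KMinorModel G h) (P : Pairing (λ i → ∣ X M i ∣) s) →
    HasBalancedKMinor G (Pairing.k P)
  balancedModelOfPairing {s = s} M P =
    modelOfSupersets M small Y (A⊆T ∘ grown) (T-connected ∘ grown) disjY ,
    λ j j' → trans (∣T∣≡m (grown j)) (≡-sym (∣T∣≡m (grown j')))
    where
    open Pairing P
    open ConnectedExtension

    pairUnion : Fin k → Subset (n G)
    pairUnion j = X M (small j) ∪ X M (large j)

    grown : ∀ j → ConnectedExtension G (X M (small j)) (pairUnion j) s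
    grown j = extend-connected G (p⊆p∪q (X M (large j))) (proj₂ (nonempty M (small j)))
      (connected M (small j)) (InducedConnected-branch-∪ M (small j) (large j))
      (small≤s j) (≤-trans (s≤large j) (∣q∣≤∣p∪q∣ (X M (small j)) (X M (large j))))

    Y : Fin k → Subset (n G)
    Y j = T (grown j)

    ∈pairUnion⇒∈branch : ∀ {j v} → v ∈ pairUnion j → ∃ λ i → i ∈ₚ j × v ∈ X M i
    ∈pairUnion⇒∈branch {j} v∈ = [ (λ v∈X → small j , inj₁ refl , v∈X) , (λ v∈X → large j , inj₂ refl , v∈X) ]′
                                   (x∈p∪q⁻ (X M (small j)) (X M (large j)) v∈)

    disjY : ∀ {j j'} → j ≢ j' → ∀ {v} → v ∈ Y j → v ∉ Y j'
    disjY j≢j' v∈Yj v∈Yj'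
      with ∈pairUnion⇒∈branch (T⊆S (grown _) v∈Yj) | ∈pairUnion⇒∈branch (T⊆S (grown _) v∈Yj')
    ... | i , i∈j , v∈Xi | i' , i'∈j' , v∈Xi' =
      disjoint M (λ { refl → j≢j' (∈ₚ-unique i∈j i'∈j') }) v∈Xi v∈Xi'

  balancedHalfMinor : ∀ {h} → KMinorModel G h → ∃ λ k → h ≤ 2 * k × HasBalancedKMinor G k
  balancedHalfMinor {zero}  M = 0 , z≤n , M , λ ()
  balancedHalfMinor {suc h} M with pairing (λ i → ∣ X M i ∣)
  ... | _ , P = Pairing.k P , Pairing.h≤2k P , balancedModelOfPairing M P

lemma4p3 : (G : Graph) (h b : ℕ) → IsHad G h → IsHadB G b →
    (h ≤ 2 * b) × (b ≤ h)
lemma4p3 G h b (Mh , h-max) ((Mb , _) , b-max) with balancedHalfMinor Mh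
... | k , h≤2k , Mk = ≤-trans h≤2k (*-monoʳ-≤ 2 (b-max k Mk)) , h-max b Mb
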